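{- For each of the following sets $R\subseteq\{0,1,2,3\}^2$ we have $(123,R)\sim_d(132,R)$: (1) $R=\{(0,0),(0,2),(1,1),(1,2),(1,3),(2,0),(2,1),(2,2),(2,3),(3,1),(3,2)\}$; (2) $R=\{(0,0),(0,2),(0,3),(1,1),(1,2),(1,3),(2,0),(2,1),(2,2),(2,3),(3,0),(3,1),(3,2)\}$.
   Context: $S_n$ denotes the set of permutations of $[n]=\{1,\dots,n\}$, written $\pi=\pi_1\cdots\pi_n$. A mesh pattern of length $k$ is a pair $(\tau,R)$ with $\tau\in S_k$ and $R\subseteq\{0,1,\dots,k\}^2$ (the shaded boxes; box $(a,b)$ is the unit square $[a,a+1]\times[b,b+1]$ in the diagram of $\tau$). An occurrence of $(\tau,R)$ in $\pi\in S_n$ is a choice of indices $i_1<\dots<i_k$ such that $\pi_{i_1}\cdots\pi_{i_k}$ is order-isomorphic to $\tau$ and, with $i_0=0$, $i_{k+1}=n+1$, $v_1<\dots<v_k$ the values $\pi_{i_1},\dots,\pi_{i_k}$ sorted increasingly, $v_0=0$, $v_{k+1}=n+1$, for every $(a,b)\in R$ there is no index $m$ with $i_a<m<i_{a+1}$ and $v_b<\pi_m<v_{b+1}$. Mesh patterns $p,q$ are equidistributed, $p\sim_d q$, if for all $n,\ell\ge0$ the number of $\pi\in S_n$ with exactly $\ell$ occurrences of $p$ equals the number with exactly $\ell$ occurrences of $q$. -}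

module Defs where

open import Data.Bool using (Bool; true; false; T; _∧_; _∨_; not)
open import Data.Nat using (ℕ; zero; suc; _+_; _<ᵇ_)
open import Data.Nat.Properties using (≤-decTotalOrder)
open import Data.Fin using (Fin; toℕ)
open import Data.Fin.Properties using () renaming (_≟_ to _≟F_)
open import Data.Vec using (Vec; []; _∷_; lookup; toList)
open import Data.List using (List; []; _∷_; _++_; map; filter; length; upTo; allFin; foldr)
open import Data.Product using (Σ; _×_; _,_; proj₁)
open import Relation.Nullary.Decidable using (⌊_⌋)
open import Relation.Binary.PropositionalEquality using (_≡_)
open import Function.Bundles using (_↔_)
open import Data.List.Sort.InsertionSort ≤-decTotalOrder using (sort)

-- Permutations of [n] in one-line notation.
-- π ∈ S_n is a vector v of length n over Fin n with pairwise distinct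
-- entries; position i (0-based) carries the value π_{i+1} = toℕ (v[i]) + 1.
-- Distinctness is a boolean check so the proof component is a
-- proposition (T b is ⊤ or ⊥).

all : {A : Set} → (A → Bool) → List A → Bool
all f = foldr (λ x r → f x ∧ r) true

distinct? : ∀ {n} → Vec (Fin n) n → Bool
distinct? {n} v =
  all (λ i → all (λ j → not (toℕ i <ᵇ toℕ j) ∨ not ⌊ lookup v i ≟F lookup v j ⌋)
                 (allFin n))
      (allFin n)

S : ℕ → Set
S n = Σ (Vec (Fin n) n) (λ v → T (distinct? v))

word : ∀ {n} → S n → List ℕ
word (v , _) = map (λ x → suc (toℕ x)) (toList v)

nth : List ℕ → ℕ → ℕ
nth []       _       = 0
nth (x ∷ xs) zero    = x
nth (x ∷ xs) (suc i) = nth xs i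

-- π_m for a 1-based position m ∈ [1,n]
at : ∀ {n} → S n → ℕ → ℕ
at π zero    = 0
at π (suc m) = nth (word π) m

subs : ℕ → List ℕ → List (List ℕ)
subs zero    xs       = [] ∷ []
subs (suc k) []       = []
subs (suc k) (x ∷ xs) = map (x ∷_) (subs k xs) ++ subs (suc k) xs

_==_ : Bool → Bool → Bool
true  == b = b
false == b = not b

-- Mesh patterns (τ , R): τ ∈ S_k, R ⊆ {0,…,k}² a list of boxes (a , b);
-- box (a , b) is the unit square [a,a+1]×[b,b+1] of the diagram of τ.

record MeshPattern : Set where
  constructor mesh
  field
    len   : ℕ
    τ     : S len
    boxes : List (ℕ × ℕ)

open MeshPattern public

isOcc : ∀ {n} → MeshPattern → S n → List ℕ → Bool
isOcc {n} p π is = orderIso ∧ all boxEmpty (boxes p)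
  where
  k   = len p
  ts  = word (τ p)
  ps  = map (at π) is
  orderIso : Bool
  orderIso = all (λ a → all (λ b → (nth ts a <ᵇ nth ts b) == (nth ps a <ᵇ nth ps b))
                            (upTo k))
                 (upTo k)
  I : List ℕ
  I = 0 ∷ (is ++ (suc n ∷ []))
  V : List ℕ
  V = 0 ∷ (sort ps ++ (suc n ∷ []))
  boxEmpty : ℕ × ℕ → Bool
  boxEmpty (a , b) =
    all (λ m → not ((nth I a <ᵇ m) ∧ (m <ᵇ nth I (suc a))
                    ∧ (nth V b <ᵇ at π m) ∧ (at π m <ᵇ nth V (suc b))))
        (map suc (upTo n))

occ : ∀ {n} → MeshPattern → S n → ℕ
occ {n} p π = length (filter (λ is → T? (isOcc p π is)) (subs (len p) (map suc (upTo n))))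
  where
  open import Relation.Nullary.Decidable using (Dec; yes; no)
  T? : (b : Bool) → Dec (T b)
  T? = Data.Bool.T?

-- p ∼_d q : for all n, ℓ the sets {π ∈ S_n : occ p π = ℓ} and
-- {π ∈ S_n : occ q π = ℓ} have the same cardinality (are in bijection).
_∼d_ : MeshPattern → MeshPattern → Set
p ∼d q = ∀ (n ℓ : ℕ) → Σ (S n) (λ π → occ p π ≡ ℓ) ↔ Σ (S n) (λ π → occ q π ≡ ℓ)

open import Data.Fin using (zero; suc)
open import Data.Unit using (tt)

p123 : S 3
p123 = (zero ∷ suc zero ∷ suc (suc zero) ∷ []) , tt

p132 : S 3
p132 = (zero ∷ suc (suc zero) ∷ suc zero ∷ []) , tt

R₁ : List (ℕ × ℕ)
R₁ = (0 , 0) ∷ (0 , 2) ∷ (1 , 1) ∷ (1 , 2) ∷ (1 , 3) ∷ (2 , 0) ∷ (2 , 1)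
   ∷ (2 , 2) ∷ (2 , 3) ∷ (3 , 1) ∷ (3 , 2) ∷ []

R₂ : List (ℕ × ℕ)
R₂ = (0 , 0) ∷ (0 , 2) ∷ (0 , 3) ∷ (1 , 1) ∷ (1 , 2) ∷ (1 , 3) ∷ (2 , 0)
   ∷ (2 , 1) ∷ (2 , 2) ∷ (2 , 3) ∷ (3 , 0) ∷ (3 , 1) ∷ (3 , 2) ∷ []

-- Both shadings contain R₁, whose column 2 and row 2 are fully shaded: an
-- occurrence of 123 or 132 at positions i < j < k has k = j + 1, and no value lies
-- strictly between its last two entries. Apart from that, the shading only sees the
-- set of the entries at j and j + 1, not their order. Call j a switch of π when
-- i, j, j + 1 is such an occurrence for some i. Switches are never adjacent, so
-- exchanging the entries at j and j + 1 for all switches j at once is well defined,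
-- and it turns the occurrences of 123 into the occurrences of 132 at the same
-- positions. The image has the same switches as π (none of the positions i - 1, i,
-- j - 1, j + 1 around a switch of the image is a switch of π), so the map is an
-- involution of S n exchanging the two occurrence counts.
module Submission where

open import Defs
open import Data.Bool using (Bool; true; false; T; not; _∧_; _∨_; if_then_else_)
open import Data.Bool.Properties using (T-∧; T-∨; T-≡; T-not-≡; T-irrelevant)
open import Data.Empty using (⊥; ⊥-elim)
open import Data.Fin using (Fin; toℕ; fromℕ<) renaming (zero to fzero; suc to fsuc)
open import Data.Fin.Properties using (toℕ-fromℕ<; toℕ-injective; toℕ<n) renaming (_≟_ to _≟F_)
open import Data.List using (List; []; _∷_; _++_; map; upTo; allFin; length; filter)
open import Data.List.Membership.Propositional using (_∈_; lose)
open import Data.List.Membership.Propositional.Properties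
  using (∈-allFin; ∈-map⁺; ∈-map⁻; ∈-upTo⁺; ∈-upTo⁻; ∈-++⁻)
open import Data.List.Relation.Unary.All as All using (All; []; _∷_)
open import Data.List.Relation.Unary.AllPairs using (AllPairs; []; _∷_)
import Data.List.Relation.Unary.AllPairs.Properties as AllPairs
open import Data.List.Relation.Unary.Any using (here; there; any?; satisfied)
open import Data.Nat using (ℕ; zero; suc; pred; _<_; _≤_; _<ᵇ_; _≤ᵇ_; _<?_; _≤?_; z≤n; s≤s; _⊓_; _⊔_)
open import Data.Nat.Properties
open import Data.List.Sort.InsertionSort ≤-decTotalOrder using (sort)
open import Data.Product using (Σ; ∃; _×_; _,_; proj₁; proj₂)
open import Data.Product.Function.Dependent.Propositional using (Σ-↔)
open import Data.Product.Properties using (≡-dec)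
open import Data.List.Membership.DecPropositional (≡-dec _≟_ _≟_) using (_∈?_)
open import Data.List.Relation.Binary.Subset.DecPropositional (≡-dec _≟_ _≟_) using (_⊆_; _⊆?_)
open import Data.Sum using (_⊎_; inj₁; inj₂)
import Data.Sum as Sum
open import Data.Vec using (Vec; lookup; toList; tabulate; _∷_)
open import Data.Vec.Properties using (lookup∘tabulate; tabulate∘lookup; tabulate-cong)
open import Function using (_∘_; _$_; id; _⇔_; mk⇔; Equivalence; _↔_; mk↔ₛ′)
open import Relation.Binary.Definitions using (tri<; tri≈; tri>)
open import Relation.Binary.PropositionalEquality
open import Relation.Nullary using (¬_; contradiction; Dec; yes; no; does)
open import Relation.Nullary.Decidable using (⌊_⌋; True; toWitness; map′; _×-dec_; dec-true; dec-false)
open import Relation.Unary using (Decidable)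

open Equivalence using (to; from)

all⇒All : ∀ {A : Set} {f : A → Bool} xs → T (all f xs) → All (T ∘ f) xs
all⇒All []       _  = []
all⇒All (x ∷ xs) fx = let fx , rest = to T-∧ fx in fx ∷ all⇒All xs rest

All⇒all : ∀ {A : Set} {f : A → Bool} xs → All (T ∘ f) xs → T (all f xs)
All⇒all []       []          = _
All⇒all (x ∷ xs) (fx ∷ rest) = from T-∧ (fx , All⇒all xs rest)

T-not : ∀ {b} → ¬ T b → T (not b)
T-not {false} _  = _
T-not {true}  ¬b = ¬b _

T-not⇒¬T : ∀ {b} → T (not b) → ¬ T b
T-not⇒¬T {true} ()

T-not-∨-not : ∀ {a b} → T (not a ∨ not b) → T a → T b → ⊥
T-not-∨-not {true} {true} ()

T-injective : ∀ {a b} → (T a → T b) → (T b → T a) → a ≡ b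
T-injective {false} {false} _   _   = refl
T-injective {false} {true}  _   b⇒a = ⊥-elim (b⇒a _)
T-injective {true}  {false} a⇒b _   = ⊥-elim (a⇒b _)
T-injective {true}  {true}  _   _   = refl

≮⇒T-not-<ᵇ : ∀ {m n} → ¬ m < n → T (not (m <ᵇ n))
≮⇒T-not-<ᵇ m≮n = T-not (m≮n ∘ <ᵇ⇒< _ _)

≤ᵇ-true : ∀ {m n} → m ≤ n → (m ≤ᵇ n) ≡ true
≤ᵇ-true = to T-≡ ∘ ≤⇒≤ᵇ

≤ᵇ-false : ∀ {m n} → ¬ m ≤ n → (m ≤ᵇ n) ≡ false
≤ᵇ-false m≰n = to T-not-≡ (T-not (m≰n ∘ ≤ᵇ⇒≤ _ _))

Position : ℕ → ℕ → Set
Position n m = 1 ≤ m × m ≤ n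

between : ∀ {n a b c} → Position n a → Position n c → a ≤ b → b ≤ c → Position n b
between (1≤a , _) (_ , c≤n) a≤b b≤c = ≤-trans 1≤a a≤b , ≤-trans b≤c c≤n

-- positions start at 1, vector indices at 0
index : ∀ {n m} → Position n m → Fin n
index {m = suc m} (_ , m<n) = fromℕ< m<n

toℕ-index : ∀ {n m} (p : Position n m) → suc (toℕ (index p)) ≡ m
toℕ-index {m = suc m} (_ , m<n) = cong suc (toℕ-fromℕ< m<n)

toℕ-position : ∀ {n} (q : Fin n) → Position n (suc (toℕ q))
toℕ-position q = s≤s z≤n , toℕ<n q

record IsPermutation (n : ℕ) (P : ℕ → ℕ) : Set where
  field
    position  : ∀ {m} → Position n m → Position n (P m)
    injective : ∀ {m m′} → Position n m → Position n m′ → P m ≡ P m′ → m ≡ m′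

-- the test that distinct? performs on the pair (q , q′)
Separated : ∀ {n} → Vec (Fin n) n → Fin n → Fin n → Bool
Separated v q q′ = not (toℕ q <ᵇ toℕ q′) ∨ not ⌊ lookup v q ≟F lookup v q′ ⌋

distinct⇒separated : ∀ {n} (v : Vec (Fin n) n) → T (distinct? v) →
                     ∀ q q′ → toℕ q < toℕ q′ → lookup v q ≢ lookup v q′
distinct⇒separated {n} v d q q′ q<q′ eq = refute (All.lookup row-q (∈-allFin q′))
  where
  row-q : All (T ∘ Separated v q) (allFin n)
  row-q = all⇒All (allFin n) (All.lookup (all⇒All (allFin n) d) (∈-allFin q))
  refute : T (Separated v q q′) → ⊥
  refute entry with lookup v q ≟F lookup v q′
  ... | yes _ = T-not-∨-not entry (<⇒<ᵇ q<q′) _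
  ... | no ne = ne eq

distinct⇒injective : ∀ {n} (v : Vec (Fin n) n) → T (distinct? v) →
                     ∀ {q q′} → lookup v q ≡ lookup v q′ → q ≡ q′
distinct⇒injective v d {q} {q′} eq with <-cmp (toℕ q) (toℕ q′)
... | tri< q<q′ _ _ = contradiction eq (distinct⇒separated v d q q′ q<q′)
... | tri≈ _ q≡q′ _ = toℕ-injective q≡q′
... | tri> _ _ q′<q = contradiction (sym eq) (distinct⇒separated v d q′ q q′<q)

injective⇒distinct : ∀ {n} (v : Vec (Fin n) n) →
                     (∀ {q q′} → lookup v q ≡ lookup v q′ → q ≡ q′) → T (distinct? v)
injective⇒distinct {n} v inj =
  All⇒all {f = λ q → all (Separated v q) (allFin n)} (allFin n) (All.tabulate λ {q} _ →
    All⇒all {f = Separated v q} (allFin n) (All.tabulate λ {q′} _ → separated q q′))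
  where
  separated : ∀ q q′ → T (Separated v q q′)
  separated q q′ with lookup v q ≟F lookup v q′
  ... | yes eq = from (T-∨ {not (toℕ q <ᵇ toℕ q′)})
                      (inj₁ (T-not λ q<q′ → <-irrefl (cong toℕ (inj eq)) (<ᵇ⇒< _ _ q<q′)))
  ... | no _   = from (T-∨ {not (toℕ q <ᵇ toℕ q′)}) (inj₂ _)

nth-map-toList : ∀ {A : Set} {k} (g : A → ℕ) (v : Vec A k) (q : Fin k) →
                 nth (map g (toList v)) (toℕ q) ≡ g (lookup v q)
nth-map-toList g (x ∷ v) fzero    = refl
nth-map-toList g (x ∷ v) (fsuc q) = nth-map-toList g v q

at-lookup : ∀ {n} (π : S n) (q : Fin n) → at π (suc (toℕ q)) ≡ suc (toℕ (lookup (proj₁ π) q))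
at-lookup (v , _) = nth-map-toList (suc ∘ toℕ) v

at-index : ∀ {n} (π : S n) {m} (p : Position n m) → at π m ≡ suc (toℕ (lookup (proj₁ π) (index p)))
at-index π p = trans (cong (at π) (sym (toℕ-index p))) (at-lookup π (index p))

at-isPermutation : ∀ {n} (π : S n) → IsPermutation n (at π)
at-isPermutation {n} π = record { position = position ; injective = injective }
  where
  position : ∀ {m} → Position n m → Position n (at π m)
  position p = subst (Position n) (sym (at-index π p)) (toℕ-position _)
  injective : ∀ {m m′} → Position n m → Position n m′ → at π m ≡ at π m′ → m ≡ m′
  injective {m} {m′} p p′ eq = begin
    m                     ≡⟨ sym (toℕ-index p) ⟩
    suc (toℕ (index p))   ≡⟨ cong (suc ∘ toℕ) same-index ⟩
    suc (toℕ (index p′))  ≡⟨ toℕ-index p′ ⟩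
    m′                    ∎
    where
    open ≡-Reasoning
    same-index : index p ≡ index p′
    same-index = distinct⇒injective (proj₁ π) (proj₂ π) (toℕ-injective (suc-injective
                   (trans (sym (at-index π p)) (trans eq (at-index π p′)))))

S-≡ : ∀ {n} {π π′ : S n} → proj₁ π ≡ proj₁ π′ → π ≡ π′
S-≡ {π = v , d} {.v , d′} refl = cong (v ,_) (T-irrelevant d d′)

at-injective : ∀ {n} {π π′ : S n} → (∀ {m} → Position n m → at π m ≡ at π′ m) → π ≡ π′
at-injective {π = π} {π′} same =
  S-≡ (trans (sym (tabulate∘lookup _)) (trans (tabulate-cong same-entry) (tabulate∘lookup _)))
  where
  same-entry : ∀ q → lookup (proj₁ π) q ≡ lookup (proj₁ π′) q
  same-entry q = toℕ-injective (suc-injective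
    (trans (sym (at-lookup π q)) (trans (same (toℕ-position q)) (at-lookup π′ q))))

reindex : ∀ {n} (π : S n) {σ : ℕ → ℕ} → IsPermutation n σ → S n
reindex {n} (v , d) {σ} σ-perm = tabulate pick , injective⇒distinct (tabulate pick) pick-injective
  where
  open IsPermutation σ-perm
  pick : Fin n → Fin n
  pick q = lookup v (index (position (toℕ-position q)))
  pick-injective : ∀ {q q′} → lookup (tabulate pick) q ≡ lookup (tabulate pick) q′ → q ≡ q′
  pick-injective {q} {q′} eq = toℕ-injective (suc-injective (injective (toℕ-position q) (toℕ-position q′)
    (trans (sym (toℕ-index _)) (trans (cong (suc ∘ toℕ) same-index) (toℕ-index _)))))
    where
    same-index : index (position (toℕ-position q)) ≡ index (position (toℕ-position q′))
    same-index = distinct⇒injective v d (trans (sym (lookup∘tabulate pick q)) (trans eq (lookup∘tabulate pick q′)))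

at-reindex : ∀ {n} (π : S n) {σ : ℕ → ℕ} (σ-perm : IsPermutation n σ) →
             ∀ {m} → Position n m → at (reindex π σ-perm) m ≡ at π (σ m)
at-reindex π {σ} σ-perm {m} p = begin
  at (reindex π σ-perm) m                                   ≡⟨ at-index (reindex π σ-perm) p ⟩
  suc (toℕ (lookup (proj₁ (reindex π σ-perm)) (index p)))   ≡⟨ cong (suc ∘ toℕ) (lookup∘tabulate _ (index p)) ⟩
  suc (toℕ (lookup (proj₁ π) (index σp)))                   ≡⟨ sym (at-index π σp) ⟩
  at π (σ (suc (toℕ (index p))))                            ≡⟨ cong (at π ∘ σ) (toℕ-index p) ⟩
  at π (σ m)                                                ∎
  where
  open ≡-Reasoning
  σp : Position _ (σ (suc (toℕ (index p))))
  σp = IsPermutation.position σ-perm (toℕ-position (index p))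

Rows : ℕ → ℕ → ℕ → ℕ → Set
Rows x y z v = v < x ⊎ (x < v × v < y) ⊎ (y < v × v < z) ⊎ z < v

rows : ∀ {x y z v} → x < y → y < z → v ≢ x → v ≢ y → v ≢ z → Rows x y z v
rows {x} {y} {z} {v} x<y y<z v≢x v≢y v≢z with <-cmp v x | <-cmp v y | <-cmp v z
... | tri< v<x _ _ | _            | _            = inj₁ v<x
... | tri> _ _ x<v | tri< v<y _ _ | _            = inj₂ (inj₁ (x<v , v<y))
... | tri> _ _ _   | tri> _ _ y<v | tri< v<z _ _ = inj₂ (inj₂ (inj₁ (y<v , v<z)))
... | tri> _ _ _   | tri> _ _ _   | tri> _ _ z<v = inj₂ (inj₂ (inj₂ z<v))
... | tri≈ _ v≡x _ | _            | _            = contradiction v≡x v≢x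
... | _            | tri≈ _ v≡y _ | _            = contradiction v≡y v≢y
... | _            | _            | tri≈ _ v≡z _ = contradiction v≡z v≢z

≢-⊓ : ∀ {v a b} → v ≢ a → v ≢ b → v ≢ a ⊓ b
≢-⊓ {v} {a} {b} v≢a v≢b with ⊓-sel a b
... | inj₁ eq = subst (v ≢_) (sym eq) v≢a
... | inj₂ eq = subst (v ≢_) (sym eq) v≢b

≢-⊔ : ∀ {v a b} → v ≢ a → v ≢ b → v ≢ a ⊔ b
≢-⊔ {v} {a} {b} v≢a v≢b with ⊔-sel a b
... | inj₁ eq = subst (v ≢_) (sym eq) v≢a
... | inj₂ eq = subst (v ≢_) (sym eq) v≢b

⊓<⊔ : ∀ {a b} → a ≢ b → a ⊓ b < a ⊔ b
⊓<⊔ {a} {b} a≢b with <-cmp a b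
... | tri< a<b _ _ rewrite m≤n⇒m⊓n≡m (<⇒≤ a<b) | m≤n⇒m⊔n≡n (<⇒≤ a<b) = a<b
... | tri≈ _ a≡b _ = contradiction a≡b a≢b
... | tri> _ _ b<a rewrite m≥n⇒m⊓n≡n (<⇒≤ b<a) | m≥n⇒m⊔n≡m (<⇒≤ b<a) = b<a

m⊓n<m⇒m⊔n≡m : ∀ {m n} → m ⊓ n < m → m ⊔ n ≡ m
m⊓n<m⇒m⊔n≡m {m} {n} m⊓n<m with ≤-total m n
... | inj₁ m≤n = contradiction (m≤n⇒m⊓n≡m m≤n) (<⇒≢ m⊓n<m)
... | inj₂ n≤m = m≥n⇒m⊔n≡m n≤m

⊓⊔-pair : ∀ {a b a′ b′} → (a′ ≡ a × b′ ≡ b) ⊎ (a′ ≡ b × b′ ≡ a) →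
          (a′ ⊓ b′ , a′ ⊔ b′) ≡ (a ⊓ b , a ⊔ b)
⊓⊔-pair         (inj₁ (refl , refl)) = refl
⊓⊔-pair {a} {b} (inj₂ (refl , refl)) = cong₂ _,_ (⊓-comm b a) (⊔-comm b a)

sort-triple : ∀ {x y z} → x < y ⊓ z → sort (x ∷ y ∷ z ∷ []) ≡ x ∷ y ⊓ z ∷ y ⊔ z ∷ []
sort-triple {x} {y} {z} x<y⊓z with y ≤? z
... | yes y≤z rewrite ≤ᵇ-true y≤z | m≤n⇒m⊓n≡m y≤z | m≤n⇒m⊔n≡n y≤z
                    | ≤ᵇ-true (<⇒≤ x<y⊓z) = refl
... | no y≰z  rewrite ≤ᵇ-false y≰z | m≥n⇒m⊓n≡n (≰⇒≥ y≰z) | m≥n⇒m⊔n≡m (≰⇒≥ y≰z)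
                    | ≤ᵇ-true (<⇒≤ x<y⊓z) = refl

swap : {A : ℕ → Set} → Decidable A → ℕ → ℕ
swap A? m = if does (A? m) then suc m else if does (A? (pred m)) then pred m else m

swap-cong : ∀ {A B : ℕ → Set} (A? : Decidable A) (B? : Decidable B) → (∀ t → A t ⇔ B t) →
            ∀ m → swap A? m ≡ swap B? m
swap-cong A? B? A⇔B m = cong₂ (λ b c → if b then suc m else if c then pred m else m)
  (same-does m) (same-does (pred m))
  where
  same-does : ∀ t → does (A? t) ≡ does (B? t)
  same-does t with A? t | B? t
  ... | yes _ | yes _ = refl
  ... | yes a | no ¬b = contradiction (to (A⇔B t) a) ¬b
  ... | no ¬a | yes b = contradiction (from (A⇔B t) b) ¬a
  ... | no _  | no _  = refl

module Swap (n : ℕ) {A : ℕ → Set} (A? : Decidable A)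
            (A-bounds : ∀ {t} → A t → 1 ≤ t × suc t ≤ n)
            (A-sparse : ∀ {t} → A t → ¬ A (suc t)) where

  σ : ℕ → ℕ
  σ = swap A?

  ¬A-0 : ¬ A 0
  ¬A-0 a = contradiction (proj₁ (A-bounds a)) λ ()

  ¬A-n : ¬ A n
  ¬A-n a = contradiction (proj₂ (A-bounds a)) (n≮n n)

  ¬A-pred : ∀ {t} → A t → ¬ A (pred t)
  ¬A-pred {zero}  a    = contradiction a ¬A-0
  ¬A-pred {suc t} a a′ = A-sparse a′ a

  σ-up : ∀ {t} → A t → σ t ≡ suc t
  σ-up {t} a rewrite dec-true (A? t) a = refl

  σ-down : ∀ {t} → A t → σ (suc t) ≡ t
  σ-down {t} a rewrite dec-false (A? (suc t)) (A-sparse a) | dec-true (A? t) a = refl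

  σ-fixed : ∀ {m} → ¬ A m → ¬ A (pred m) → σ m ≡ m
  σ-fixed {m} ¬a ¬a′ rewrite dec-false (A? m) ¬a | dec-false (A? (pred m)) ¬a′ = refl

  data View : ℕ → Set where
    up    : ∀ {t} → A t → View t
    down  : ∀ {t} → A t → View (suc t)
    fixed : ∀ {m} → ¬ A m → ¬ A (pred m) → View m

  view : ∀ m → View m
  view m with A? m
  ... | yes a = up a
  view zero    | no ¬a = fixed ¬a ¬a
  view (suc t) | no ¬a with A? t
  ... | yes a′ = down a′
  ... | no ¬a′ = fixed ¬a ¬a′

  σ-involutive : ∀ m → σ (σ m) ≡ m
  σ-involutive m with view m
  ... | up a         = trans (cong σ (σ-up a)) (σ-down a)
  ... | down a       = trans (cong σ (σ-down a)) (σ-up a)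
  ... | fixed ¬a ¬a′ = trans (cong σ (σ-fixed ¬a ¬a′)) (σ-fixed ¬a ¬a′)

  σ-position : ∀ {m} → Position n m → Position n (σ m)
  σ-position {m} m-pos with view m
  ... | up a         rewrite σ-up a         = s≤s z≤n , proj₂ (A-bounds a)
  ... | down a       rewrite σ-down a       = proj₁ (A-bounds a) , ≤-trans (n≤1+n _) (proj₂ (A-bounds a))
  ... | fixed ¬a ¬a′ rewrite σ-fixed ¬a ¬a′ = m-pos

  σ-isPermutation : IsPermutation n σ
  σ-isPermutation = record
    { position  = σ-position
    ; injective = λ {m} {m′} _ _ eq → trans (sym (σ-involutive m)) (trans (cong σ eq) (σ-involutive m′))
    }

  σ-between : ∀ {c d m} → ¬ A c → ¬ A (pred d) → c < m → m < d → c < σ m × σ m < d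
  σ-between {c} {d} {m} ¬c ¬d c<m m<d with view m
  ... | up a         rewrite σ-up a         = m<n⇒m<1+n c<m , ≤∧≢⇒< m<d λ { refl → ¬d a }
  ... | down {t} a   rewrite σ-down a       = ≤∧≢⇒< (≤-pred c<m) (λ { refl → ¬c a }) , <-trans (n<1+n t) m<d
  ... | fixed ¬a ¬a′ rewrite σ-fixed ¬a ¬a′ = c<m , m<d

  σ-pair : ∀ {j} → ¬ A (pred j) → ¬ A (suc j) →
           (σ j ≡ j × σ (suc j) ≡ suc j) ⊎ (σ j ≡ suc j × σ (suc j) ≡ j)
  σ-pair {j} ¬j-1 ¬j+1 with view j
  ... | up a       = inj₂ (σ-up a , σ-down a)
  ... | down a     = contradiction a ¬j-1
  ... | fixed ¬a _ = inj₁ (σ-fixed ¬a ¬j-1 , σ-fixed ¬j+1 ¬a)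

cuts : ℕ → ℕ → ℕ → ℕ → List ℕ
cuts n a b c = 0 ∷ a ∷ b ∷ c ∷ suc n ∷ []

record InBox (P : ℕ → ℕ) (I V : List ℕ) (ab : ℕ × ℕ) (m : ℕ) : Set where
  constructor box
  field
    right-of : nth I (proj₁ ab) < m
    left-of  : m < nth I (suc (proj₁ ab))
    above    : nth V (proj₂ ab) < P m
    below    : P m < nth V (suc (proj₂ ab))

BoxesEmpty : (ℕ → ℕ) → ℕ → List ℕ → List ℕ → List (ℕ × ℕ) → Set
BoxesEmpty P n I V R = ∀ {ab m} → ab ∈ R → Position n m → ¬ InBox P I V ab m

boxEmptyᵇ : (ℕ → ℕ) → ℕ → List ℕ → List ℕ → ℕ × ℕ → Bool
boxEmptyᵇ P n I V (a , b) =
  all (λ m → not ((nth I a <ᵇ m) ∧ (m <ᵇ nth I (suc a)) ∧ (nth V b <ᵇ P m) ∧ (P m <ᵇ nth V (suc b))))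
      (map suc (upTo n))

∈-positions⁻ : ∀ {n m} → m ∈ map suc (upTo n) → Position n m
∈-positions⁻ m∈ with ∈-map⁻ suc m∈
... | _ , m′∈ , refl = s≤s z≤n , ∈-upTo⁻ m′∈

∈-positions⁺ : ∀ {n m} → Position n m → m ∈ map suc (upTo n)
∈-positions⁺ {m = suc m} (_ , m<n) = ∈-map⁺ suc (∈-upTo⁺ m<n)

module _ (P : ℕ → ℕ) (n : ℕ) (I V : List ℕ) where

  T-inBox⇒InBox : ∀ a b m →
    T ((nth I a <ᵇ m) ∧ (m <ᵇ nth I (suc a)) ∧ (nth V b <ᵇ P m) ∧ (P m <ᵇ nth V (suc b))) →
    InBox P I V (a , b) m
  T-inBox⇒InBox a b m t =
    let c₁ , t = to T-∧ t ; c₂ , t = to T-∧ t ; c₃ , c₄ = to T-∧ t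
    in box (<ᵇ⇒< _ _ c₁) (<ᵇ⇒< _ _ c₂) (<ᵇ⇒< _ _ c₃) (<ᵇ⇒< _ _ c₄)

  boxesEmpty⇒ : ∀ R → T (all (boxEmptyᵇ P n I V) R) → BoxesEmpty P n I V R
  boxesEmpty⇒ R t {a , b} {m} ab∈R m-pos (box c₁ c₂ c₃ c₄) =
    T-not⇒¬T (All.lookup (all⇒All _ (All.lookup (all⇒All R t) ab∈R)) (∈-positions⁺ m-pos))
      (from T-∧ (<⇒<ᵇ c₁ , from T-∧ (<⇒<ᵇ c₂ , from T-∧ (<⇒<ᵇ c₃ , <⇒<ᵇ c₄))))

  boxesEmpty⇐ : ∀ R → BoxesEmpty P n I V R → T (all (boxEmptyᵇ P n I V) R)
  boxesEmpty⇐ R empty = All⇒all R (All.tabulate λ { {a , b} ab∈R →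
    All⇒all (map suc (upTo n)) (All.tabulate λ {m} m∈ →
      T-not (empty ab∈R (∈-positions⁻ m∈) ∘ T-inBox⇒InBox a b m)) })

  boxesEmpty? : ∀ R → Dec (BoxesEmpty P n I V R)
  boxesEmpty? R = map′ (boxesEmpty⇒ R) (boxesEmpty⇐ R) (Data.Bool.T? (all (boxEmptyᵇ P n I V) R))

boxesEmpty-transport : ∀ {P Q n I V R} (τ : ℕ → ℕ) →
  (∀ {m} → Position n m → Position n (τ m)) →
  (∀ a {m} → Position n m → nth I a < m → m < nth I (suc a) → nth I a < τ m × τ m < nth I (suc a)) →
  (∀ {m} → Position n m → Q m ≡ P (τ m)) →
  BoxesEmpty P n I V R → BoxesEmpty Q n I V R
boxesEmpty-transport {V = V} τ τ-position τ-column Q≡Pτ empty {a , b} ab∈R m-pos (box c₁ c₂ c₃ c₄) =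
  empty ab∈R (τ-position m-pos)
    (box (proj₁ (τ-column a m-pos c₁ c₂)) (proj₂ (τ-column a m-pos c₁ c₂))
         (subst (nth V b <_) (Q≡Pτ m-pos) c₃) (subst (_< nth V (suc b)) (Q≡Pτ m-pos) c₄))

orderEntryᵇ : List ℕ → List ℕ → ℕ → ℕ → Bool
orderEntryᵇ ts ps a b = (nth ts a <ᵇ nth ts b) == (nth ps a <ᵇ nth ps b)

orderIsoᵇ : List ℕ → List ℕ → Bool
orderIsoᵇ ts ps = all (λ a → all (orderEntryᵇ ts ps a) (upTo 3)) (upTo 3)

OrderTable : List ℕ → List ℕ → Set
OrderTable ts ps = All (λ a → All (T ∘ orderEntryᵇ ts ps a) (upTo 3)) (upTo 3)

orderIso⇒table : ∀ ts ps → T (orderIsoᵇ ts ps) → OrderTable ts ps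
orderIso⇒table _ _ t = All.map (all⇒All (upTo 3)) (all⇒All (upTo 3) t)

table⇒orderIso : ∀ ts ps → OrderTable ts ps → T (orderIsoᵇ ts ps)
table⇒orderIso _ _ table = All⇒all (upTo 3) (All.map (All⇒all (upTo 3)) table)

module _ {x y z : ℕ} where

  orderIso-123⇒ : T (orderIsoᵇ (word p123) (x ∷ y ∷ z ∷ [])) → x < y × y < z
  orderIso-123⇒ t with orderIso⇒table (word p123) (x ∷ y ∷ z ∷ []) t
  ... | (_ ∷ x<y ∷ _) ∷ (_ ∷ _ ∷ y<z ∷ _) ∷ _ = <ᵇ⇒< x y x<y , <ᵇ⇒< y z y<z

  orderIso-123⇐ : x < y → y < z → T (orderIsoᵇ (word p123) (x ∷ y ∷ z ∷ []))
  orderIso-123⇐ x<y y<z = table⇒orderIso (word p123) (x ∷ y ∷ z ∷ [])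
    ( (≮⇒T-not-<ᵇ (n≮n x)      ∷ <⇒<ᵇ x<y                 ∷ <⇒<ᵇ x<z                 ∷ [])
    ∷ (≮⇒T-not-<ᵇ (<⇒≯ x<y)   ∷ ≮⇒T-not-<ᵇ (n≮n y)      ∷ <⇒<ᵇ y<z                 ∷ [])
    ∷ (≮⇒T-not-<ᵇ (<⇒≯ x<z)   ∷ ≮⇒T-not-<ᵇ (<⇒≯ y<z)   ∷ ≮⇒T-not-<ᵇ (n≮n z)      ∷ [])
    ∷ [])
    where
    x<z : x < z
    x<z = <-trans x<y y<z

  orderIso-132⇒ : T (orderIsoᵇ (word p132) (x ∷ y ∷ z ∷ [])) → x < z × z < y
  orderIso-132⇒ t with orderIso⇒table (word p132) (x ∷ y ∷ z ∷ []) t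
  ... | (_ ∷ _ ∷ x<z ∷ _) ∷ _ ∷ (_ ∷ z<y ∷ _) ∷ _ = <ᵇ⇒< x z x<z , <ᵇ⇒< z y z<y

  orderIso-132⇐ : x < z → z < y → T (orderIsoᵇ (word p132) (x ∷ y ∷ z ∷ []))
  orderIso-132⇐ x<z z<y = table⇒orderIso (word p132) (x ∷ y ∷ z ∷ [])
    ( (≮⇒T-not-<ᵇ (n≮n x)      ∷ <⇒<ᵇ x<y                 ∷ <⇒<ᵇ x<z                 ∷ [])
    ∷ (≮⇒T-not-<ᵇ (<⇒≯ x<y)   ∷ ≮⇒T-not-<ᵇ (n≮n y)      ∷ ≮⇒T-not-<ᵇ (<⇒≯ z<y)   ∷ [])
    ∷ (≮⇒T-not-<ᵇ (<⇒≯ x<z)   ∷ <⇒<ᵇ z<y                 ∷ ≮⇒T-not-<ᵇ (n≮n z)      ∷ [])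
    ∷ [])
    where
    x<y : x < y
    x<y = <-trans x<z z<y

length-filter-cong : ∀ {A : Set} (f g : A → Bool) xs → (∀ {x} → x ∈ xs → f x ≡ g x) →
  length (filter (Data.Bool.T? ∘ f) xs) ≡ length (filter (Data.Bool.T? ∘ g) xs)
length-filter-cong f g []       _   = refl
length-filter-cong f g (x ∷ xs) f≗g with f x | g x | f≗g (here refl) | length-filter-cong f g xs (f≗g ∘ there)
... | true  | .true  | refl | same = cong suc same
... | false | .false | refl | same = same

subs-sorted : ∀ k xs {ys} → AllPairs _<_ xs → ys ∈ subs k xs →
              All (_∈ xs) ys × AllPairs _<_ ys × length ys ≡ k
subs-sorted zero    xs       _ (here refl) = [] , [] , refl
subs-sorted (suc k) (x ∷ xs) (x<xs ∷ xs-sorted) ys∈ with ∈-++⁻ (map (x ∷_) (subs k xs)) ys∈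
... | inj₂ ys∈′ = let ys⊆ , ys-sorted , ys-length = subs-sorted (suc k) xs xs-sorted ys∈′
                  in All.map there ys⊆ , ys-sorted , ys-length
... | inj₁ x∷zs∈ with ∈-map⁻ (x ∷_) x∷zs∈
...   | zs , zs∈ , refl = let zs⊆ , zs-sorted , zs-length = subs-sorted k xs xs-sorted zs∈
                          in here refl ∷ All.map there zs⊆
                           , All.map (All.lookup x<xs) zs⊆ ∷ zs-sorted
                           , cong suc zs-length

data Triple (n : ℕ) : List ℕ → Set where
  triple : ∀ {i j k} → Position n i → Position n k → i < j → j < k → Triple n (i ∷ j ∷ k ∷ [])

triple-positions : ∀ {n ys} → ys ∈ subs 3 (map suc (upTo n)) → Triple n ys
triple-positions {n} ys∈ with subs-sorted 3 _ positions-sorted ys∈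
  where
  positions-sorted : AllPairs _<_ (map suc (upTo n))
  positions-sorted = AllPairs.map⁺ (AllPairs.applyUpTo⁺₁ id n (λ i<j _ → s≤s i<j))
... | i∈ ∷ _ ∷ k∈ ∷ [] , (i<j ∷ _) ∷ (j<k ∷ []) ∷ [] ∷ [] , refl =
  triple (∈-positions⁻ i∈) (∈-positions⁻ k∈) i<j j<k

fibres-↔ : ∀ {A : Set} (f : A → A) → (∀ x → f (f x) ≡ x) →
           (h₁ h₂ : A → ℕ) → (∀ x → h₁ x ≡ h₂ (f x)) → ∀ ℓ → Σ A (λ x → h₁ x ≡ ℓ) ↔ Σ A (λ x → h₂ x ≡ ℓ)
fibres-↔ f f-involutive h₁ h₂ h₁≡h₂∘f ℓ =
  Σ-↔ (mk↔ₛ′ f f f-involutive f-involutive)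
      (mk↔ₛ′ (trans (sym (h₁≡h₂∘f _))) (trans (h₁≡h₂∘f _))
             (λ _ → ≡-irrelevant _ _) (λ _ → ≡-irrelevant _ _))

module Shaded (R : List (ℕ × ℕ)) (R₁⊆R : R₁ ⊆ R) (n : ℕ) where

  shaded : ∀ ab → {True (ab ∈? R₁)} → ab ∈ R
  shaded ab {ab∈R₁} = R₁⊆R (toWitness ab∈R₁)

  -- an occurrence of 123 or of 132 at i, j, j + 1, up to the order of the
  -- entries at j and j + 1
  record Switch (P : ℕ → ℕ) (i j : ℕ) : Set where
    constructor switch
    field
      1≤i   : 1 ≤ i
      i<j   : i < j
      j<n   : j < n
      below : P i < P j ⊓ P (suc j)
      empty : BoxesEmpty P n (cuts n i j (suc j)) (cuts n (P i) (P j ⊓ P (suc j)) (P j ⊔ P (suc j))) R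

    i-pos : Position n i
    i-pos = 1≤i , ≤-trans (<⇒≤ i<j) (<⇒≤ j<n)

    j-pos : Position n j
    j-pos = ≤-trans 1≤i (<⇒≤ i<j) , <⇒≤ j<n

    j+1-pos : Position n (suc j)
    j+1-pos = s≤s z≤n , j<n

  switch? : ∀ P i j → Dec (Switch P i j)
  switch? P i j with 1 ≤? i ×-dec i <? j ×-dec j <? n ×-dec P i <? P j ⊓ P (suc j) ×-dec
                     boxesEmpty? P n (cuts n i j (suc j)) (cuts n (P i) (P j ⊓ P (suc j)) (P j ⊔ P (suc j))) R
  ... | yes (a , b , c , d , e) = yes (switch a b c d e)
  ... | no ¬sw = no λ (switch a b c d e) → ¬sw (a , b , c , d , e)

  SwitchAt : (ℕ → ℕ) → ℕ → Set
  SwitchAt P j = ∃ λ i → Switch P i j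

  switchAt? : ∀ P j → Dec (SwitchAt P j)
  switchAt? P j = map′ satisfied (λ (i , sw) → lose (∈-upTo⁺ (Switch.i<j sw)) sw)
                       (any? (λ i → switch? P i j) (upTo j))

  module _ {P : ℕ → ℕ} (P-perm : IsPermutation n P) where
    open IsPermutation P-perm

    other-rows : ∀ {i j k m} → Position n i → Position n j → Position n k → j ≢ k → P i < P j ⊓ P k →
      Position n m → m ≢ i → m ≢ j → m ≢ k → Rows (P i) (P j ⊓ P k) (P j ⊔ P k) (P m)
    other-rows i-pos j-pos k-pos j≢k below m-pos m≢i m≢j m≢k =
      rows below (⊓<⊔ (j≢k ∘ injective j-pos k-pos)) (m≢i ∘ injective m-pos i-pos)
           (≢-⊓ (m≢j ∘ injective m-pos j-pos) (m≢k ∘ injective m-pos k-pos))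
           (≢-⊔ (m≢j ∘ injective m-pos j-pos) (m≢k ∘ injective m-pos k-pos))

    last-two-adjacent : ∀ {i j k} → Position n i → Position n k → i < j → j < k → P i < P j ⊓ P k →
                        BoxesEmpty P n (cuts n i j k) (cuts n (P i) (P j ⊓ P k) (P j ⊔ P k)) R → k ≡ suc j
    last-two-adjacent {i} {j} {k} i-pos k-pos i<j j<k below empty with <-cmp (suc j) k
    ... | tri≈ _ j+1≡k _ = sym j+1≡k
    ... | tri> _ _ k<j+1 = contradiction j<k (≤⇒≯ (≤-pred k<j+1))
    ... | tri< j+1<k _ _ = ⊥-elim (occupied (other-rows i-pos j-pos k-pos (<⇒≢ j<k) below m-pos
                                    (>⇒≢ (<-trans i<j (n<1+n j))) (>⇒≢ (n<1+n j)) (<⇒≢ j+1<k)))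
      where
      j-pos : Position n j
      j-pos = between i-pos k-pos (<⇒≤ i<j) (<⇒≤ j<k)
      m-pos : Position n (suc j)
      m-pos = between i-pos k-pos (<⇒≤ (<-trans i<j (n<1+n j))) (<⇒≤ j+1<k)
      V : List ℕ
      V = cuts n (P i) (P j ⊓ P k) (P j ⊔ P k)
      column-2 : ∀ b → (2 , b) ∈ R → nth V b < P (suc j) → P (suc j) < nth V (suc b) → ⊥
      column-2 b 2b∈R c d = empty 2b∈R m-pos (box (n<1+n j) j+1<k c d)
      occupied : Rows (P i) (P j ⊓ P k) (P j ⊔ P k) (P (suc j)) → ⊥
      occupied (inj₁ d)                     = column-2 0 (shaded (2 , 0)) (proj₁ (position m-pos)) d
      occupied (inj₂ (inj₁ (c , d)))        = column-2 1 (shaded (2 , 1)) c d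
      occupied (inj₂ (inj₂ (inj₁ (c , d)))) = column-2 2 (shaded (2 , 2)) c d
      occupied (inj₂ (inj₂ (inj₂ c)))       = column-2 3 (shaded (2 , 3)) c (s≤s (proj₂ (position m-pos)))

    module SwitchFacts {i j} (sw : Switch P i j) where
      open Switch sw

      larger-before : ∀ {m} → Position n m → m < i → P i < P m
      larger-before m-pos m<i =
        ≤∧≢⇒< (≮⇒≥ λ Pm<Pi →
                  empty (shaded (0 , 0)) m-pos (box (proj₁ m-pos) m<i (proj₁ (position m-pos)) Pm<Pi))
              (λ Pi≡Pm → <⇒≢ m<i (injective m-pos i-pos (sym Pi≡Pm)))

      smaller-between : ∀ {m} → i < m → m < j → P m < P i
      smaller-between {m} i<m m<j = occupied (other-rows i-pos j-pos j+1-pos (<⇒≢ (n<1+n j)) below m-pos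
                                      (>⇒≢ i<m) (<⇒≢ m<j) (<⇒≢ (m<n⇒m<1+n m<j)))
        where
        m-pos : Position n m
        m-pos = between i-pos j-pos (<⇒≤ i<m) (<⇒≤ m<j)
        occupied : Rows (P i) (P j ⊓ P (suc j)) (P j ⊔ P (suc j)) (P m) → P m < P i
        occupied (inj₁ Pm<Pi)                 = Pm<Pi
        occupied (inj₂ (inj₁ (c , d)))        = ⊥-elim (empty (shaded (1 , 1)) m-pos (box i<m m<j c d))
        occupied (inj₂ (inj₂ (inj₁ (c , d)))) = ⊥-elim (empty (shaded (1 , 2)) m-pos (box i<m m<j c d))
        occupied (inj₂ (inj₂ (inj₂ c)))       =
          ⊥-elim (empty (shaded (1 , 3)) m-pos (box i<m m<j c (s≤s (proj₂ (position m-pos)))))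

      no-value-between : ∀ {m} → Position n m → P j ⊓ P (suc j) < P m → P m < P j ⊔ P (suc j) → ⊥
      no-value-between {m} m-pos c d with <-cmp m i | <-cmp m j | <-cmp m (suc j)
      ... | tri< m<i _ _  | _              | _               = empty (shaded (0 , 2)) m-pos (box (proj₁ m-pos) m<i c d)
      ... | tri≈ _ refl _ | _              | _               = <-asym below c
      ... | tri> _ _ i<m  | tri< m<j _ _   | _               = empty (shaded (1 , 2)) m-pos (box i<m m<j c d)
      ... | _             | tri≈ _ refl _  | _               = <-irrefl (sym (m⊓n<m⇒m⊔n≡m c)) d
      ... | _             | _              | tri≈ _ refl _   =
        <-irrefl (sym (trans (⊔-comm (P j) (P m)) (m⊓n<m⇒m⊔n≡m (subst (_< P m) (⊓-comm (P j) (P m)) c)))) d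
      ... | _             | tri> _ _ j<m   | tri< m<j+1 _ _  = <⇒≱ j<m (≤-pred m<j+1)
      ... | _             | _              | tri> _ _ j+1<m  =
        empty (shaded (3 , 2)) m-pos (box j+1<m (s≤s (proj₂ m-pos)) c d)

    open SwitchFacts public
    open Switch using (i-pos; i<j; below)

    switch⇒¬switchAt-i : ∀ {i j} → Switch P i j → ¬ SwitchAt P i
    switch⇒¬switchAt-i sw (i′ , sw′) =
      <-asym (larger-before sw (i-pos sw′) (i<j sw′)) (<-≤-trans (below sw′) (m⊓n≤m _ _))

    switch⇒¬switchAt-i-1 : ∀ {i j} → Switch P i j → ¬ SwitchAt P (pred i)
    switch⇒¬switchAt-i-1 {suc t} sw (i′ , sw′) =
      <-asym (larger-before sw (i-pos sw′) (m<n⇒m<1+n (i<j sw′))) (<-≤-trans (below sw′) (m⊓n≤n _ _))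

    switchAt-sparse : ∀ {j} → SwitchAt P j → ¬ SwitchAt P (suc j)
    switchAt-sparse {j} (i , sw) (i′ , sw′) with <-cmp i′ j
    ... | tri< i′<j _ _ = no-value-between sw (i-pos sw′)
                            (≤-<-trans (m⊓n≤m _ _) (smaller-between sw′ i′<j (n<1+n j)))
                                             (<-≤-trans (<-≤-trans (below sw′) (m⊓n≤m _ _)) (m≤n⊔m _ _))
    ... | tri≈ _ refl _ = switch⇒¬switchAt-i sw′ (i , sw)
    ... | tri> _ _ j<i′ = <⇒≱ (i<j sw′) j<i′

    switchAt-bounds : ∀ {j} → SwitchAt P j → 1 ≤ j × suc j ≤ n
    switchAt-bounds (_ , switch 1≤i i<j j<n _ _) = ≤-trans 1≤i (<⇒≤ i<j) , j<n

  module _ {A : ℕ → Set} (A? : Decidable A) (A-bounds : ∀ {t} → A t → 1 ≤ t × suc t ≤ n)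
           (A-sparse : ∀ {t} → A t → ¬ A (suc t)) where
    open Swap n A? A-bounds A-sparse

    -- σ keeps every position in its column strip and fixes the values at i and {j, j + 1}
    switch-transport : ∀ {P Q i j} → (∀ {m} → Position n m → Q m ≡ P (σ m)) →
      ¬ A (pred i) → ¬ A i → ¬ A (pred j) → ¬ A (suc j) → Switch P i j → Switch Q i j
    switch-transport {P} {Q} {i} {j} Q≡Pσ ¬i-1 ¬i ¬j-1 ¬j+1 sw@(switch 1≤i i<j j<n below empty) =
      switch 1≤i i<j j<n (proj₁ transported) (proj₂ transported)
      where
      open Switch sw using (i-pos; j-pos; j+1-pos)
      I : List ℕ
      I = cuts n i j (suc j)
      Q≡P : ∀ {m m′} → Position n m → σ m ≡ m′ → Q m ≡ P m′
      Q≡P m-pos σm≡m′ = trans (Q≡Pσ m-pos) (cong P σm≡m′)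
      values : (Q i , Q j ⊓ Q (suc j) , Q j ⊔ Q (suc j)) ≡ (P i , P j ⊓ P (suc j) , P j ⊔ P (suc j))
      values = cong₂ _,_ (Q≡P i-pos (σ-fixed ¬i ¬i-1))
                         (⊓⊔-pair (Sum.map (λ (e , e′) → Q≡P j-pos e , Q≡P j+1-pos e′)
                                           (λ (e , e′) → Q≡P j-pos e , Q≡P j+1-pos e′)
                                           (σ-pair ¬j-1 ¬j+1)))
      σ-column : ∀ a {m} → Position n m → nth I a < m → m < nth I (suc a) → nth I a < σ m × σ m < nth I (suc a)
      σ-column 0 _ = σ-between ¬A-0 ¬i-1
      σ-column 1 _ = σ-between ¬i ¬j-1
      σ-column 2 _ j<m m<j+1 = contradiction (≤-pred m<j+1) (<⇒≱ j<m)
      σ-column 3 _ = σ-between ¬j+1 ¬A-n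
      σ-column (suc (suc (suc (suc a)))) _ _ ()
      transported : Q i < Q j ⊓ Q (suc j) × BoxesEmpty Q n I (cuts n (Q i) (Q j ⊓ Q (suc j)) (Q j ⊔ Q (suc j))) R
      transported = subst (λ (x , lo , hi) → x < lo × BoxesEmpty Q n I (cuts n x lo hi) R) (sym values)
                          (below , boxesEmpty-transport σ σ-position σ-column Q≡Pσ empty)

  module Swapping {P : ℕ → ℕ} (P-perm : IsPermutation n P) where
    open Swap n (switchAt? P) (switchAt-bounds P-perm) (switchAt-sparse P-perm) public
    open Switch using (i-pos; j-pos; j+1-pos; i<j; below)

    -- the positions i - 1, i, j - 1, j + 1 around a switch of Q are not switches of P,
    -- so σ carries it back to a switch of P
    module Swapped {Q : ℕ → ℕ} (Q-perm : IsPermutation n Q) (Q≡Pσ : ∀ {m} → Position n m → Q m ≡ P (σ m)) where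

      P-switch-start : ∀ {i j} → Switch P i j → Q i ≡ P i
      P-switch-start sw = trans (Q≡Pσ (i-pos sw))
        (cong P (σ-fixed (switch⇒¬switchAt-i P-perm sw) (switch⇒¬switchAt-i-1 P-perm sw)))

      P-switch-pair : ∀ {i j} → Switch P i j → Q j ≡ P (suc j) × Q (suc j) ≡ P j
      P-switch-pair sw = trans (Q≡Pσ (j-pos sw)) (cong P (σ-up (_ , sw)))
                       , trans (Q≡Pσ (j+1-pos sw)) (cong P (σ-down (_ , sw)))

      P-switch⇒Q-switch : ∀ {i j} → Switch P i j → Switch Q i j
      P-switch⇒Q-switch sw = switch-transport (switchAt? P) (switchAt-bounds P-perm) (switchAt-sparse P-perm) Q≡Pσ
        (switch⇒¬switchAt-i-1 P-perm sw) (switch⇒¬switchAt-i P-perm sw)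
        (¬A-pred (_ , sw)) (switchAt-sparse P-perm (_ , sw)) sw

      Q-start-below-P-switch : ∀ {i j i′ t} → Switch Q i j → Switch P i′ t → i′ < i →
                               P t ⊓ P (suc t) ≤ Q i → ⊥
      Q-start-below-P-switch {i} {j} {i′} {t} sq sp i′<i lo′≤Qi = <-irrefl refl $ begin-strict
        Q i             <⟨ larger-before Q-perm sq (i-pos sp) i′<i ⟩
        Q i′            ≡⟨ P-switch-start sp ⟩
        P i′            <⟨ below sp ⟩
        P t ⊓ P (suc t) ≤⟨ lo′≤Qi ⟩
        Q i             ∎
        where open ≤-Reasoning

      Q-switch⇒¬switchAt-i : ∀ {i j} → Switch Q i j → ¬ SwitchAt P i
      Q-switch⇒¬switchAt-i {i} sq (i′ , sp) =
        Q-start-below-P-switch sq sp (i<j sp) (subst (_ ≤_) (sym Qi≡Pi+1) (m⊓n≤n _ _))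
        where
        Qi≡Pi+1 : Q i ≡ P (suc i)
        Qi≡Pi+1 = trans (Q≡Pσ (i-pos sq)) (cong P (σ-up (i′ , sp)))

      Q-switch⇒¬switchAt-i-1 : ∀ {i j} → Switch Q i j → ¬ SwitchAt P (pred i)
      Q-switch⇒¬switchAt-i-1 {suc t} sq (i′ , sp) =
        Q-start-below-P-switch sq sp (m<n⇒m<1+n (i<j sp)) (subst (_ ≤_) (sym Qi≡Pt) (m⊓n≤m _ _))
        where
        Qi≡Pt : Q (suc t) ≡ P t
        Qi≡Pt = trans (Q≡Pσ (i-pos sq)) (cong P (σ-down (i′ , sp)))

      Q-switch-start : ∀ {i j} → Switch Q i j → Q i ≡ P i
      Q-switch-start sq = trans (Q≡Pσ (i-pos sq))
        (cong P (σ-fixed (Q-switch⇒¬switchAt-i sq) (Q-switch⇒¬switchAt-i-1 sq)))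

      Q-switch⇒¬switchAt-j-1 : ∀ {i j} → Switch Q i j → ¬ SwitchAt P (pred j)
      Q-switch⇒¬switchAt-j-1 {i} {suc t} sq (i′ , sp) = no-value-between P-perm sp (i-pos sq) lo′<Pi Pi<hi′
        where
        open ≤-Reasoning
        i<t : i < t
        i<t = ≤∧≢⇒< (≤-pred (i<j sq)) λ { refl → Q-switch⇒¬switchAt-i sq (i′ , sp) }
        lo′<Pi : P t ⊓ P (suc t) < P i
        lo′<Pi = begin-strict
          P t ⊓ P (suc t) ≤⟨ m⊓n≤n _ _ ⟩
          P (suc t)       ≡⟨ sym (proj₁ (P-switch-pair sp)) ⟩
          Q t             <⟨ smaller-between Q-perm sq i<t (n<1+n t) ⟩
          Q i             ≡⟨ Q-switch-start sq ⟩
          P i             ∎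
        Pi<hi′ : P i < P t ⊔ P (suc t)
        Pi<hi′ = begin-strict
          P i                         ≡⟨ sym (Q-switch-start sq) ⟩
          Q i                         <⟨ below sq ⟩
          Q (suc t) ⊓ Q (suc (suc t)) ≤⟨ m⊓n≤m _ _ ⟩
          Q (suc t)                   ≡⟨ proj₂ (P-switch-pair sp) ⟩
          P t                         ≤⟨ m≤m⊔n _ _ ⟩
          P t ⊔ P (suc t)             ∎

      Q-switch-j : ∀ {i j} → Switch Q i j → SwitchAt P (suc j) → Q j ≡ P j
      Q-switch-j sq j+1-switch =
        trans (Q≡Pσ (j-pos sq)) (cong P (σ-fixed (¬A-pred j+1-switch) (Q-switch⇒¬switchAt-j-1 sq)))

      Q-switch⇒¬switchAt-j+1 : ∀ {i j} → Switch Q i j → ¬ SwitchAt P (suc j)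
      Q-switch⇒¬switchAt-j+1 {i} {j} sq (i′ , sp) with <-cmp i′ j
      ... | tri< i′<j _ _ = no-value-between Q-perm sq (i-pos sp) lo<Qi′ Qi′<hi
        where
        open ≤-Reasoning
        lo<Qi′ : Q j ⊓ Q (suc j) < Q i′
        lo<Qi′ = begin-strict
          Q j ⊓ Q (suc j) ≤⟨ m⊓n≤m _ _ ⟩
          Q j             ≡⟨ Q-switch-j sq (_ , sp) ⟩
          P j             <⟨ smaller-between P-perm sp i′<j (n<1+n j) ⟩
          P i′            ≡⟨ sym (P-switch-start sp) ⟩
          Q i′            ∎
        Qi′<hi : Q i′ < Q j ⊔ Q (suc j)
        Qi′<hi = begin-strict
          Q i′                        ≡⟨ P-switch-start sp ⟩
          P i′                        <⟨ below sp ⟩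
          P (suc j) ⊓ P (suc (suc j)) ≤⟨ m⊓n≤n _ _ ⟩
          P (suc (suc j))             ≡⟨ sym (proj₁ (P-switch-pair sp)) ⟩
          Q (suc j)                   ≤⟨ m≤n⊔m _ _ ⟩
          Q j ⊔ Q (suc j)             ∎
      ... | tri≈ _ refl _ = <-irrefl refl $ begin-strict
          P j             <⟨ larger-before P-perm sp (i-pos sq) (i<j sq) ⟩
          P i             ≡⟨ sym (Q-switch-start sq) ⟩
          Q i             <⟨ below sq ⟩
          Q j ⊓ Q (suc j) ≤⟨ m⊓n≤m _ _ ⟩
          Q j             ≡⟨ Q-switch-j sq (_ , sp) ⟩
          P j             ∎
        where open ≤-Reasoning
      ... | tri> _ _ j<i′ = <⇒≱ (i<j sp) j<i′

      Q-switch⇒P-switch : ∀ {i j} → Switch Q i j → Switch P i j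
      Q-switch⇒P-switch sq = switch-transport (switchAt? P) (switchAt-bounds P-perm) (switchAt-sparse P-perm) P≡Qσ
        (Q-switch⇒¬switchAt-i-1 sq) (Q-switch⇒¬switchAt-i sq)
        (Q-switch⇒¬switchAt-j-1 sq) (Q-switch⇒¬switchAt-j+1 sq) sq
        where
        P≡Qσ : ∀ {m} → Position n m → P m ≡ Q (σ m)
        P≡Qσ m-pos = trans (cong P (sym (σ-involutive _))) (sym (Q≡Pσ (σ-position m-pos)))

      switchAt-Q⇔P : ∀ t → SwitchAt Q t ⇔ SwitchAt P t
      switchAt-Q⇔P t = mk⇔ (λ (i , sq) → i , Q-switch⇒P-switch sq) (λ (i , sp) → i , P-switch⇒Q-switch sp)

  module Occurrences (π : S n) where
    P : ℕ → ℕ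
    P = at π

    sortedBoxes : ℕ → ℕ → ℕ → Bool
    sortedBoxes i j k = all (boxEmptyᵇ P n (cuts n i j k) (0 ∷ (sort (P i ∷ P j ∷ P k ∷ []) ++ suc n ∷ []))) R

    isOcc-split : ∀ τ i j k → T (isOcc (mesh 3 τ R) π (i ∷ j ∷ k ∷ [])) ⇔
                  (T (orderIsoᵇ (word τ) (P i ∷ P j ∷ P k ∷ [])) × T (sortedBoxes i j k))
    isOcc-split τ i j k = T-∧

    sortedBoxes⇔boxesEmpty : ∀ {i j k} → P i < P j ⊓ P k →
      T (sortedBoxes i j k) ⇔ BoxesEmpty P n (cuts n i j k) (cuts n (P i) (P j ⊓ P k) (P j ⊔ P k)) R
    sortedBoxes⇔boxesEmpty {i} {j} {k} below rewrite sort-triple below =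
      mk⇔ (boxesEmpty⇒ _ _ _ _ R) (boxesEmpty⇐ _ _ _ _ R)

    sortedBoxes⇒switch : ∀ {i j k} → Position n i → Position n k → i < j → j < k → P i < P j ⊓ P k →
                         T (sortedBoxes i j k) → k ≡ suc j × Switch P i j
    sortedBoxes⇒switch i-pos k-pos i<j j<k below boxes
      with empty ← to (sortedBoxes⇔boxesEmpty below) boxes
      with refl ← last-two-adjacent (at-isPermutation π) i-pos k-pos i<j j<k below empty
      = refl , switch (proj₁ i-pos) i<j (proj₂ k-pos) below empty

    switch⇒sortedBoxes : ∀ {i j} → Switch P i j → T (sortedBoxes i j (suc j))
    switch⇒sortedBoxes sw = from (sortedBoxes⇔boxesEmpty (Switch.below sw)) (Switch.empty sw)

    occurs-123⇒ : ∀ {i j k} → Position n i → Position n k → i < j → j < k →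
                  T (isOcc (mesh 3 p123 R) π (i ∷ j ∷ k ∷ [])) → k ≡ suc j × Switch P i j × P j < P (suc j)
    occurs-123⇒ {i} {j} {k} i-pos k-pos i<j j<k occ
      with order , boxes ← to (isOcc-split p123 i j k) occ
      with Pi<Pj , Pj<Pk ← orderIso-123⇒ order
      with refl , sw ← sortedBoxes⇒switch i-pos k-pos i<j j<k (⊓-glb Pi<Pj (<-trans Pi<Pj Pj<Pk)) boxes
      = refl , sw , Pj<Pk

    occurs-123⇐ : ∀ {i j} → Switch P i j → P j < P (suc j) → T (isOcc (mesh 3 p123 R) π (i ∷ j ∷ suc j ∷ []))
    occurs-123⇐ {i} {j} sw Pj<Pj+1 = from (isOcc-split p123 i j (suc j))
      (orderIso-123⇐ (<-≤-trans (Switch.below sw) (m⊓n≤m _ _)) Pj<Pj+1 , switch⇒sortedBoxes sw)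

    occurs-132⇒ : ∀ {i j k} → Position n i → Position n k → i < j → j < k →
                  T (isOcc (mesh 3 p132 R) π (i ∷ j ∷ k ∷ [])) → k ≡ suc j × Switch P i j × P (suc j) < P j
    occurs-132⇒ {i} {j} {k} i-pos k-pos i<j j<k occ
      with order , boxes ← to (isOcc-split p132 i j k) occ
      with Pi<Pk , Pk<Pj ← orderIso-132⇒ order
      with refl , sw ← sortedBoxes⇒switch i-pos k-pos i<j j<k (⊓-glb (<-trans Pi<Pk Pk<Pj) Pi<Pk) boxes
      = refl , sw , Pk<Pj

    occurs-132⇐ : ∀ {i j} → Switch P i j → P (suc j) < P j → T (isOcc (mesh 3 p132 R) π (i ∷ j ∷ suc j ∷ []))
    occurs-132⇐ {i} {j} sw Pj+1<Pj = from (isOcc-split p132 i j (suc j))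
      (orderIso-132⇐ (<-≤-trans (Switch.below sw) (m⊓n≤n _ _)) Pj+1<Pj , switch⇒sortedBoxes sw)

  open Occurrences using (occurs-123⇒; occurs-123⇐; occurs-132⇒; occurs-132⇐)

  -- opaque: with-abstraction would otherwise normalise goals mentioning toggle π
  opaque
    toggle : S n → S n
    toggle π = reindex π (Swapping.σ-isPermutation (at-isPermutation π))

    at-toggle : ∀ π {m} → Position n m → at (toggle π) m ≡ at π (Swapping.σ (at-isPermutation π) m)
    at-toggle π = at-reindex π (Swapping.σ-isPermutation (at-isPermutation π))

  module Toggle (π : S n) where
    open Swapping (at-isPermutation π) public
    open Swapped (at-isPermutation (toggle π)) (at-toggle π) public

  toggle-involutive : ∀ π → toggle (toggle π) ≡ π
  toggle-involutive π = at-injective λ {m} m-pos → begin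
    at (toggle (toggle π)) m  ≡⟨ at-toggle (toggle π) m-pos ⟩
    at (toggle π) (T′.σ m)    ≡⟨ at-toggle π (T′.σ-position m-pos) ⟩
    at π (T.σ (T′.σ m))       ≡⟨ cong (at π ∘ T.σ) (same-σ m) ⟩
    at π (T.σ (T.σ m))        ≡⟨ cong (at π) (T.σ-involutive m) ⟩
    at π m                    ∎
    where
    open ≡-Reasoning
    module T = Toggle π
    module T′ = Toggle (toggle π)
    same-σ : ∀ m → T′.σ m ≡ T.σ m
    same-σ = swap-cong (switchAt? (at (toggle π))) (switchAt? (at π)) T.switchAt-Q⇔P

  module _ (π : S n) {i j k : ℕ} (i-pos : Position n i) (k-pos : Position n k) (i<j : i < j) (j<k : j < k) where
    open Toggle π

    occurs-123⇒toggle-132 : T (isOcc (mesh 3 p123 R) π (i ∷ j ∷ k ∷ [])) →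
                            T (isOcc (mesh 3 p132 R) (toggle π) (i ∷ j ∷ k ∷ []))
    occurs-123⇒toggle-132 occ with refl , sw , Pj<Pj+1 ← occurs-123⇒ π i-pos k-pos i<j j<k occ =
      occurs-132⇐ (toggle π) (P-switch⇒Q-switch sw)
        (subst₂ _<_ (sym (proj₂ (P-switch-pair sw))) (sym (proj₁ (P-switch-pair sw))) Pj<Pj+1)

    toggle-132⇒occurs-123 : T (isOcc (mesh 3 p132 R) (toggle π) (i ∷ j ∷ k ∷ [])) →
                            T (isOcc (mesh 3 p123 R) π (i ∷ j ∷ k ∷ []))
    toggle-132⇒occurs-123 occ with refl , sq , Qj+1<Qj ← occurs-132⇒ (toggle π) i-pos k-pos i<j j<k occ =
      occurs-123⇐ π sp (subst₂ _<_ (proj₂ (P-switch-pair sp)) (proj₁ (P-switch-pair sp)) Qj+1<Qj)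
      where
      sp : Switch (at π) i j
      sp = Q-switch⇒P-switch sq

  occ-toggle : ∀ π → occ (mesh 3 p123 R) π ≡ occ (mesh 3 p132 R) (toggle π)
  occ-toggle π = length-filter-cong (isOcc (mesh 3 p123 R) π) (isOcc (mesh 3 p132 R) (toggle π))
                                    (subs 3 (map suc (upTo n))) (same-occurrences ∘ triple-positions {n})
    where
    same-occurrences : ∀ {ys} → Triple n ys → isOcc (mesh 3 p123 R) π ys ≡ isOcc (mesh 3 p132 R) (toggle π) ys
    same-occurrences (triple i-pos k-pos i<j j<k) =
      T-injective (occurs-123⇒toggle-132 π i-pos k-pos i<j j<k) (toggle-132⇒occurs-123 π i-pos k-pos i<j j<k)

  equidistributed : ∀ ℓ → Σ (S n) (λ π → occ (mesh 3 p123 R) π ≡ ℓ) ↔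
                          Σ (S n) (λ π → occ (mesh 3 p132 R) π ≡ ℓ)
  equidistributed = fibres-↔ toggle toggle-involutive (occ (mesh 3 p123 R)) (occ (mesh 3 p132 R)) occ-toggle

R₁⊆R₂ : R₁ ⊆ R₂
R₁⊆R₂ = toWitness {a? = R₁ ⊆? R₂} _

theorem3p8 : (mesh 3 p123 R₁ ∼d mesh 3 p132 R₁) × (mesh 3 p123 R₂ ∼d mesh 3 p132 R₂)
theorem3p8 = Shaded.equidistributed R₁ id , Shaded.equidistributed R₂ R₁⊆R₂
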